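{- For every oriented graph $D$: (i) $2\hom_{IV}(D)\ge \hom_{III}(D)$; (ii) $\hom_{III}(D)\ge 2\hom_{I}(D)$; (iii) $2\hom_{IV}(D)+\hom_{III}(D)\ge \hom_{II}(D)$; (iv) $\hom_{IV}(D)\ge \hom_{I}(D)$; (v) $4\hom_{IV}(D)\ge \hom_{II}(D)$.
   Context: All graphs are finite and simple. For oriented graphs $H,D$, a homomorphism from $H$ to $D$ is a map $f:V(H)\to V(D)$ such that $\vec{f(x)f(y)}$ is an arc of $D$ for every arc $\vec{xy}$ of $H$; $\hom(H,D)$ is the number of such maps. Consider the cycle on vertices $1,2,3,4$ with edges $12,23,34,41$; each of its 16 orientations is classified as follows: call the edge $\{i,i+1\}$ (indices mod 4) forward if it is oriented from $i$ to $i+1$. Type I: 0 or 4 forward edges; Type II: 1 or 3 forward edges; Type III: exactly 2 forward edges which are consecutive around the cycle; Type IV: exactly 2 forward edges which are non-consecutive. For $T\in\{I,II,III,IV\}$, $\hom_T(D)$ is the sum of $\hom(H,D)$ over the orientations $H$ of this cycle of type $T$. -}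

module Defs where

open import Data.Nat using (ℕ; zero; suc; _+_; _*_; _≤_)
open import Data.Fin using (Fin; zero; suc)
open import Data.Bool using (Bool; true; false; if_then_else_; _∧_)
open import Relation.Binary.PropositionalEquality using (_≡_)

record OrientedGraph : Set where
  field
    n     : ℕ
    arc   : Fin n → Fin n → Bool
    irrefl : ∀ x → arc x x ≡ false
    asym   : ∀ x y → arc x y ≡ true → arc y x ≡ false

sumFin : (n : ℕ) → (Fin n → ℕ) → ℕ
sumFin zero    f = 0
sumFin (suc n) f = f zero + sumFin n (λ i → f (suc i))

sumBool : (Bool → ℕ) → ℕ
sumBool f = f true + f false

toℕ' : Bool → ℕ
toℕ' true  = 1
toℕ' false = 0

-- An orientation of the 4-cycle 1-2-3-4-1 is given by four Booleans
-- (b₁,b₂,b₃,b₄), where bᵢ = true iff edge {i,i+1} (indices mod 4) is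
-- oriented forward, i.e. from i to i+1.
-- Arc condition for edge {i,i+1} with images u = f(i), v = f(i+1):
edgeOK : (D : OrientedGraph) → Bool → Fin (OrientedGraph.n D) → Fin (OrientedGraph.n D) → Bool
edgeOK D true  u v = OrientedGraph.arc D u v
edgeOK D false u v = OrientedGraph.arc D v u

homC4 : (D : OrientedGraph) → Bool → Bool → Bool → Bool → ℕ
homC4 D b₁ b₂ b₃ b₄ =
  sumFin n λ x₁ → sumFin n λ x₂ → sumFin n λ x₃ → sumFin n λ x₄ →
    toℕ' (edgeOK D b₁ x₁ x₂ ∧ edgeOK D b₂ x₂ x₃ ∧ edgeOK D b₃ x₃ x₄ ∧ edgeOK D b₄ x₄ x₁)
  where n = OrientedGraph.n D

data Type : Set where
  I II III IV : Type

forwards : Bool → Bool → Bool → Bool → ℕ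
forwards b₁ b₂ b₃ b₄ = toℕ' b₁ + toℕ' b₂ + toℕ' b₃ + toℕ' b₄

typeOf : Bool → Bool → Bool → Bool → Type
typeOf b₁ b₂ b₃ b₄ with forwards b₁ b₂ b₃ b₄
... | 0 = I
... | 1 = II
... | 3 = II
... | 4 = I
... | _ = if (b₁ ∧ b₃) then IV else (if (b₂ ∧ b₄) then IV else III)

_≟T_ : Type → Type → Bool
I   ≟T I   = true
II  ≟T II  = true
III ≟T III = true
IV  ≟T IV  = true
_   ≟T _   = false

homT : Type → OrientedGraph → ℕ
homT T D =
  sumBool λ b₁ → sumBool λ b₂ → sumBool λ b₃ → sumBool λ b₄ →
    if typeOf b₁ b₂ b₃ b₄ ≟T T then homC4 D b₁ b₂ b₃ b₄ else 0

module Submission where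

-- Write W_{b,b'}(x,z) for the number of two-step walks
-- x → y → z in D whose steps are oriented as prescribed by b and b'.
-- Cutting the 4-cycle at its vertices 1 and 3 shows
--     hom(b₁b₂b₃b₄, D) = ⟪ W_{b₁,b₂} , W_{b₃,b₄}ᵀ ⟫,
-- a Frobenius inner product of non-negative integer matrices, and
-- reversing a walk gives W_{b,b'}ᵀ = W_{¬b',¬b}.  The entrywise AM-GM
-- inequality 2⟪F,G⟫ ≤ ⟪F,F⟫ + ⟪G,G⟫ therefore yields the Cauchy-Schwarz
-- type bound
--     2·hom(b₁b₂b₃b₄) ≤ hom(b₁b₂¬b₂¬b₁) + hom(b₃b₄¬b₄¬b₃).
-- Together with invariance of hom under rotating the cycle, this gives
-- five inequalities between the homomorphism counts of six representative
-- orientations.  Finally each hom_T is a sum over rotation classes, and the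
-- five statements of the lemma are linear consequences.

open import Defs
open import Data.Nat using (ℕ; zero; suc; _+_; _*_; _≤_; _≥_)
open import Data.Nat.Properties
open import Data.Nat.Tactic.RingSolver using (solve-∀)
open import Data.Product using (_×_; _,_)
open import Data.Sum using (inj₁; inj₂)
open import Data.Fin using (Fin; zero; suc)
open import Data.Bool using (Bool; true; false; _∧_; not; if_then_else_)
open import Relation.Binary.PropositionalEquality
open import Algebra.Properties.Semiring.Sum +-*-semiring
  using (sum; sum-syntax; sum-cong-≗; ∑-comm; ∑-distrib-+; *-distribˡ-sum; *-distribʳ-sum)

-- The sums of Defs agree with the library's finite sums, which lets us use
-- the library's interchange and distributivity laws.
sumFin-≗ : ∀ n {f g : Fin n → ℕ} → (∀ i → f i ≡ g i) → sumFin n f ≡ sum g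
sumFin-≗ zero    f≗g = refl
sumFin-≗ (suc n) f≗g = cong₂ _+_ (f≗g zero) (sumFin-≗ n (λ i → f≗g (suc i)))

sum-mono : ∀ {n} {f g : Fin n → ℕ} → (∀ i → f i ≤ g i) → sum f ≤ sum g
sum-mono {zero}  f≤g = ≤-refl
sum-mono {suc n} f≤g = +-mono-≤ (f≤g zero) (sum-mono (λ i → f≤g (suc i)))

-- AM-GM for natural numbers, first for a ≤ b: writing b = a + d, the gap
-- a² + b² − 2ab is exactly d².
amgm-ordered : ∀ a b → a ≤ b → 2 * (a * b) ≤ a * a + b * b
amgm-ordered a b a≤b with m≤n⇒∃[o]m+o≡n a≤b
... | d , refl = subst (2 * (a * (a + d)) ≤_) (gap a d) (m≤m+n _ (d * d))
  where
  gap : ∀ a d → 2 * (a * (a + d)) + d * d ≡ a * a + (a + d) * (a + d)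
  gap = solve-∀

2ab≤a²+b² : ∀ a b → 2 * (a * b) ≤ a * a + b * b
2ab≤a²+b² a b with ≤-total a b
... | inj₁ a≤b = amgm-ordered a b a≤b
... | inj₂ b≤a = subst₂ _≤_ (cong (2 *_) (*-comm b a)) (+-comm (b * b) (a * a)) (amgm-ordered b a b≤a)

sum-double-≤ : ∀ {n} {a b c : Fin n → ℕ} → (∀ i → 2 * a i ≤ b i + c i) →
  2 * sum a ≤ sum b + sum c
sum-double-≤ {n} {a} {b} {c} bound = begin
  2 * sum a                  ≡⟨ *-distribˡ-sum 2 a ⟩
  sum (λ i → 2 * a i)        ≤⟨ sum-mono bound ⟩
  sum (λ i → b i + c i)      ≡⟨ ∑-distrib-+ b c ⟩
  sum b + sum c              ∎
  where open ≤-Reasoning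

Matrix : ℕ → ℕ → Set
Matrix m k = Fin m → Fin k → ℕ

_ᵀ : ∀ {m k} → Matrix m k → Matrix k m
(F ᵀ) j i = F i j

⟪_,_⟫ : ∀ {m k} → Matrix m k → Matrix m k → ℕ
⟪_,_⟫ {m} {k} F G = ∑[ i < m ] ∑[ j < k ] (F i j * G i j)

⟪⟫-ᵀ : ∀ {m k} (F G : Matrix m k) → ⟪ F ᵀ , G ᵀ ⟫ ≡ ⟪ F , G ⟫
⟪⟫-ᵀ F G = ∑-comm (λ j i → F i j * G i j)

⟪⟫-congʳ : ∀ {m k} (F : Matrix m k) {G G' : Matrix m k} → (∀ i j → G i j ≡ G' i j) →
  ⟪ F , G ⟫ ≡ ⟪ F , G' ⟫
⟪⟫-congʳ F G≗G' = sum-cong-≗ λ i → sum-cong-≗ λ j → cong (F i j *_) (G≗G' i j)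

⟪⟫-amgm : ∀ {m k} (F G : Matrix m k) → 2 * ⟪ F , G ⟫ ≤ ⟪ F , F ⟫ + ⟪ G , G ⟫
⟪⟫-amgm F G = sum-double-≤ (λ i → sum-double-≤ (λ j → 2ab≤a²+b² (F i j) (G i j)))

toℕ'-∧ : ∀ p q → toℕ' (p ∧ q) ≡ toℕ' p * toℕ' q
toℕ'-∧ true  q = sym (+-identityʳ (toℕ' q))
toℕ'-∧ false q = refl

module CycleCounts (D : OrientedGraph) where
  open OrientedGraph D using (n)

  edge : Bool → Fin n → Fin n → ℕ
  edge b u v = toℕ' (edgeOK D b u v)

  edge-reverse : ∀ b u v → edge (not b) v u ≡ edge b u v
  edge-reverse true  u v = refl
  edge-reverse false u v = refl

  walks : Bool → Bool → Matrix n n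
  walks b b' x z = ∑[ y < n ] (edge b x y * edge b' y z)

  walks-reverse : ∀ b b' x z → walks (not b') (not b) z x ≡ walks b b' x z
  walks-reverse b b' x z = sum-cong-≗ λ y → begin
    edge (not b') z y * edge (not b) y x ≡⟨ cong₂ _*_ (edge-reverse b' y z) (edge-reverse b x y) ⟩
    edge b' y z * edge b x y             ≡⟨ *-comm (edge b' y z) (edge b x y) ⟩
    edge b x y * edge b' y z             ∎
    where open ≡-Reasoning

  homC4-as-sum : ∀ b₁ b₂ b₃ b₄ → homC4 D b₁ b₂ b₃ b₄ ≡
    ∑[ x₁ < n ] ∑[ x₂ < n ] ∑[ x₃ < n ] ∑[ x₄ < n ]
      ((edge b₁ x₁ x₂ * edge b₂ x₂ x₃) * (edge b₃ x₃ x₄ * edge b₄ x₄ x₁))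
  homC4-as-sum b₁ b₂ b₃ b₄ =
    sumFin-≗ n λ x₁ → sumFin-≗ n λ x₂ → sumFin-≗ n λ x₃ → sumFin-≗ n λ x₄ →
      indicator (edgeOK D b₁ x₁ x₂) (edgeOK D b₂ x₂ x₃) (edgeOK D b₃ x₃ x₄) (edgeOK D b₄ x₄ x₁)
    where
    indicator : ∀ p q r s → toℕ' (p ∧ q ∧ r ∧ s) ≡ (toℕ' p * toℕ' q) * (toℕ' r * toℕ' s)
    indicator p q r s = begin
      toℕ' (p ∧ q ∧ r ∧ s)                  ≡⟨ toℕ'-∧ p (q ∧ r ∧ s) ⟩
      toℕ' p * toℕ' (q ∧ r ∧ s)             ≡⟨ cong (toℕ' p *_) (toℕ'-∧ q (r ∧ s)) ⟩
      toℕ' p * (toℕ' q * toℕ' (r ∧ s))      ≡⟨ cong (λ e → toℕ' p * (toℕ' q * e)) (toℕ'-∧ r s) ⟩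
      toℕ' p * (toℕ' q * (toℕ' r * toℕ' s)) ≡⟨ *-assoc (toℕ' p) (toℕ' q) _ ⟨
      (toℕ' p * toℕ' q) * (toℕ' r * toℕ' s) ∎
      where open ≡-Reasoning

  -- Relabelling the cycle vertices 1,2,3,4 as 4,1,2,3 rotates the
  -- orientation pattern without changing the count.
  homC4-rotate : ∀ b₁ b₂ b₃ b₄ → homC4 D b₁ b₂ b₃ b₄ ≡ homC4 D b₂ b₃ b₄ b₁
  homC4-rotate b₁ b₂ b₃ b₄ = begin
    homC4 D b₁ b₂ b₃ b₄
      ≡⟨ homC4-as-sum b₁ b₂ b₃ b₄ ⟩
    ∑[ x₁ < n ] ∑[ x₂ < n ] ∑[ x₃ < n ] ∑[ x₄ < n ] P x₁ x₂ x₃ x₄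
      ≡⟨ ∑-comm (λ x₁ x₂ → ∑[ x₃ < n ] ∑[ x₄ < n ] P x₁ x₂ x₃ x₄) ⟩
    ∑[ x₂ < n ] ∑[ x₁ < n ] ∑[ x₃ < n ] ∑[ x₄ < n ] P x₁ x₂ x₃ x₄
      ≡⟨ sum-cong-≗ (λ x₂ → ∑-comm (λ x₁ x₃ → ∑[ x₄ < n ] P x₁ x₂ x₃ x₄)) ⟩
    ∑[ x₂ < n ] ∑[ x₃ < n ] ∑[ x₁ < n ] ∑[ x₄ < n ] P x₁ x₂ x₃ x₄
      ≡⟨ sum-cong-≗ (λ x₂ → sum-cong-≗ λ x₃ → ∑-comm (λ x₁ x₄ → P x₁ x₂ x₃ x₄)) ⟩
    ∑[ x₂ < n ] ∑[ x₃ < n ] ∑[ x₄ < n ] ∑[ x₁ < n ] P x₁ x₂ x₃ x₄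
      ≡⟨ sum-cong-≗ (λ x₂ → sum-cong-≗ λ x₃ → sum-cong-≗ λ x₄ → sum-cong-≗ λ x₁ →
           rotate-product (edge b₁ x₁ x₂) (edge b₂ x₂ x₃) (edge b₃ x₃ x₄) (edge b₄ x₄ x₁)) ⟩
    ∑[ x₂ < n ] ∑[ x₃ < n ] ∑[ x₄ < n ] ∑[ x₁ < n ]
      ((edge b₂ x₂ x₃ * edge b₃ x₃ x₄) * (edge b₄ x₄ x₁ * edge b₁ x₁ x₂))
      ≡⟨ homC4-as-sum b₂ b₃ b₄ b₁ ⟨
    homC4 D b₂ b₃ b₄ b₁ ∎
    where
    open ≡-Reasoning
    P : Fin n → Fin n → Fin n → Fin n → ℕ
    P x₁ x₂ x₃ x₄ = (edge b₁ x₁ x₂ * edge b₂ x₂ x₃) * (edge b₃ x₃ x₄ * edge b₄ x₄ x₁)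
    rotate-product : ∀ a b c d → (a * b) * (c * d) ≡ (b * c) * (d * a)
    rotate-product = solve-∀

  -- Cutting the cycle at vertices 1 and 3: the count is the inner product
  -- of the walk matrices of the two halves 1 → 2 → 3 and 3 → 4 → 1.
  homC4-factor : ∀ b₁ b₂ b₃ b₄ → homC4 D b₁ b₂ b₃ b₄ ≡ ⟪ walks b₁ b₂ , (walks b₃ b₄) ᵀ ⟫
  homC4-factor b₁ b₂ b₃ b₄ = begin
    homC4 D b₁ b₂ b₃ b₄
      ≡⟨ homC4-as-sum b₁ b₂ b₃ b₄ ⟩
    ∑[ x₁ < n ] ∑[ x₂ < n ] ∑[ x₃ < n ] ∑[ x₄ < n ] (first x₁ x₂ x₃ * second x₃ x₄ x₁)
      ≡⟨ sum-cong-≗ (λ x₁ → sum-cong-≗ λ x₂ → sum-cong-≗ λ x₃ →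
           *-distribˡ-sum (first x₁ x₂ x₃) (λ x₄ → second x₃ x₄ x₁)) ⟨
    ∑[ x₁ < n ] ∑[ x₂ < n ] ∑[ x₃ < n ] (first x₁ x₂ x₃ * walks b₃ b₄ x₃ x₁)
      ≡⟨ sum-cong-≗ (λ x₁ → ∑-comm (λ x₂ x₃ → first x₁ x₂ x₃ * walks b₃ b₄ x₃ x₁)) ⟩
    ∑[ x₁ < n ] ∑[ x₃ < n ] ∑[ x₂ < n ] (first x₁ x₂ x₃ * walks b₃ b₄ x₃ x₁)
      ≡⟨ sum-cong-≗ (λ x₁ → sum-cong-≗ λ x₃ →
           *-distribʳ-sum (walks b₃ b₄ x₃ x₁) (λ x₂ → first x₁ x₂ x₃)) ⟨
    ⟪ walks b₁ b₂ , (walks b₃ b₄) ᵀ ⟫ ∎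
    where
    open ≡-Reasoning
    first : Fin n → Fin n → Fin n → ℕ
    first x₁ x₂ x₃ = edge b₁ x₁ x₂ * edge b₂ x₂ x₃
    second : Fin n → Fin n → Fin n → ℕ
    second x₃ x₄ x₁ = edge b₃ x₃ x₄ * edge b₄ x₄ x₁

  -- The squared norm of a walk matrix is again a cycle count: close the
  -- walk by walking it backwards.
  walks-norm : ∀ b b' → ⟪ walks b b' , walks b b' ⟫ ≡ homC4 D b b' (not b') (not b)
  walks-norm b b' = begin
    ⟪ walks b b' , walks b b' ⟫
      ≡⟨ ⟪⟫-congʳ (walks b b') (λ x z → walks-reverse b b' x z) ⟨
    ⟪ walks b b' , (walks (not b') (not b)) ᵀ ⟫
      ≡⟨ homC4-factor b b' (not b') (not b) ⟨
    homC4 D b b' (not b') (not b) ∎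
    where open ≡-Reasoning

  homC4-amgm : ∀ b₁ b₂ b₃ b₄ →
    2 * homC4 D b₁ b₂ b₃ b₄ ≤ homC4 D b₁ b₂ (not b₂) (not b₁) + homC4 D b₃ b₄ (not b₄) (not b₃)
  homC4-amgm b₁ b₂ b₃ b₄ = begin
    2 * homC4 D b₁ b₂ b₃ b₄
      ≡⟨ cong (2 *_) (homC4-factor b₁ b₂ b₃ b₄) ⟩
    2 * ⟪ walks b₁ b₂ , (walks b₃ b₄) ᵀ ⟫
      ≤⟨ ⟪⟫-amgm (walks b₁ b₂) ((walks b₃ b₄) ᵀ) ⟩
    ⟪ walks b₁ b₂ , walks b₁ b₂ ⟫ + ⟪ (walks b₃ b₄) ᵀ , (walks b₃ b₄) ᵀ ⟫
      ≡⟨ cong₂ _+_ (walks-norm b₁ b₂)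
           (trans (⟪⟫-ᵀ (walks b₃ b₄) (walks b₃ b₄)) (walks-norm b₃ b₄)) ⟩
    homC4 D b₁ b₂ (not b₂) (not b₁) + homC4 D b₃ b₄ (not b₄) (not b₃) ∎
    where open ≤-Reasoning

OrientationCount : Set
OrientationCount = Bool → Bool → Bool → Bool → ℕ

typeSum : Type → OrientationCount → ℕ
typeSum T g = sumBool λ b₁ → sumBool λ b₂ → sumBool λ b₃ → sumBool λ b₄ →
  if typeOf b₁ b₂ b₃ b₄ ≟T T then g b₁ b₂ b₃ b₄ else 0

orbitSum : OrientationCount → OrientationCount
orbitSum g b₁ b₂ b₃ b₄ = g b₁ b₂ b₃ b₄ + g b₂ b₃ b₄ b₁ + g b₃ b₄ b₁ b₂ + g b₄ b₁ b₂ b₃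

RotationInvariant : OrientationCount → Set
RotationInvariant g = ∀ b₁ b₂ b₃ b₄ → g b₁ b₂ b₃ b₄ ≡ g b₂ b₃ b₄ b₁

orbitSum-invariant : ∀ g → RotationInvariant g → ∀ b₁ b₂ b₃ b₄ →
  orbitSum g b₁ b₂ b₃ b₄ ≡ 4 * g b₁ b₂ b₃ b₄
orbitSum-invariant g rot b₁ b₂ b₃ b₄ = begin
  x + g b₂ b₃ b₄ b₁ + g b₃ b₄ b₁ b₂ + g b₄ b₁ b₂ b₃ ≡⟨ cong₂ _+_ (cong₂ _+_ (cong (x +_) r₁) r₂) r₃ ⟨
  x + x + x + x                                    ≡⟨ four x ⟩
  4 * x                                            ∎
  where
  open ≡-Reasoning
  x = g b₁ b₂ b₃ b₄
  r₁ = rot b₁ b₂ b₃ b₄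
  r₂ = trans r₁ (rot b₂ b₃ b₄ b₁)
  r₃ = trans r₂ (rot b₃ b₄ b₁ b₂)
  four : ∀ x → x + x + x + x ≡ 4 * x
  four = solve-∀

-- The orientations of each type, read off from the definition of typeOf:
-- type I are TTTT and FFFF, type II the rotations of TFFF and of TTTF,
-- type III the rotations of TTFF, type IV are TFTF and FTFT.  In the
-- left-hand sides the sixteen orientations appear in the order
-- TTTT, TTTF, …, FFFF, with 0 for those of another type.
typeSum-I : ∀ g → typeSum I g ≡ g true true true true + g false false false false
typeSum-I g = regroup (g true true true true) (g false false false false)
  where
  regroup : ∀ a b →
    (((a + 0) + (0 + 0)) + ((0 + 0) + (0 + 0))) +
    (((0 + 0) + (0 + 0)) + ((0 + 0) + (0 + b))) ≡ a + b
  regroup = solve-∀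

typeSum-II : ∀ g → typeSum II g ≡ orbitSum g true false false false + orbitSum g true true true false
typeSum-II g = regroup
  (g true true true false) (g true true false true) (g true false true true) (g true false false false)
  (g false true true true) (g false true false false) (g false false true false) (g false false false true)
  where
  regroup : ∀ a b c d e f g h →
    (((0 + a) + (b + 0)) + ((c + 0) + (0 + d))) +
    (((e + 0) + (0 + f)) + ((0 + g) + (h + 0))) ≡ (d + h + g + f) + (a + b + c + e)
  regroup = solve-∀

typeSum-III : ∀ g → typeSum III g ≡ orbitSum g true true false false
typeSum-III g = regroup
  (g true true false false) (g true false false true) (g false true true false) (g false false true true)
  where
  regroup : ∀ a b c d →
    (((0 + 0) + (0 + a)) + ((0 + 0) + (b + 0))) +
    (((0 + c) + (0 + 0)) + ((d + 0) + (0 + 0))) ≡ a + b + d + c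
  regroup = solve-∀

typeSum-IV : ∀ g → typeSum IV g ≡ g true false true false + g false true false true
typeSum-IV g = regroup (g true false true false) (g false true false true)
  where
  regroup : ∀ a b →
    (((0 + 0) + (0 + 0)) + ((0 + a) + (0 + 0))) +
    (((0 + 0) + (b + 0)) + ((0 + 0) + (0 + 0))) ≡ a + b
  regroup = solve-∀

-- The five statements of the theorem are linear consequences of
-- t, t' ≤ s ≤ q and 2u, 2w ≤ q + s, where hom_I = t + t',
-- hom_II = 4u + 4w, hom_III = 4s and hom_IV = 2q.
linear-consequences : ∀ {hI hII hIII hIV : ℕ} (q s t t' u w : ℕ) →
  hI ≡ t + t' → hII ≡ 4 * u + 4 * w → hIII ≡ 4 * s → hIV ≡ 2 * q →
  t ≤ s → t' ≤ s → s ≤ q → 2 * u ≤ q + s → 2 * w ≤ q + s →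
  (2 * hIV ≥ hIII) × (hIII ≥ 2 * hI) × (2 * hIV + hIII ≥ hII) × (hIV ≥ hI) × (4 * hIV ≥ hII)
linear-consequences q s t t' u w refl refl refl refl t≤s t'≤s s≤q 2u≤ 2w≤ =
  i , ii , iii , iv , v
  where
  open ≤-Reasoning
  i : 4 * s ≤ 2 * (2 * q)
  i = begin
    4 * s       ≤⟨ *-monoʳ-≤ 4 s≤q ⟩
    4 * q       ≡⟨ *-assoc 2 2 q ⟩
    2 * (2 * q) ∎
  ii : 2 * (t + t') ≤ 4 * s
  ii = begin
    2 * (t + t') ≤⟨ *-monoʳ-≤ 2 (+-mono-≤ t≤s t'≤s) ⟩
    2 * (s + s)  ≡⟨ double s ⟩
    4 * s        ∎
    where
    double : ∀ s → 2 * (s + s) ≡ 4 * s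
    double = solve-∀
  iii : 4 * u + 4 * w ≤ 2 * (2 * q) + 4 * s
  iii = begin
    4 * u + 4 * w             ≡⟨ cong₂ _+_ (*-assoc 2 2 u) (*-assoc 2 2 w) ⟩
    2 * (2 * u) + 2 * (2 * w) ≤⟨ +-mono-≤ (*-monoʳ-≤ 2 2u≤) (*-monoʳ-≤ 2 2w≤) ⟩
    2 * (q + s) + 2 * (q + s) ≡⟨ collect q s ⟩
    2 * (2 * q) + 4 * s       ∎
    where
    collect : ∀ q s → 2 * (q + s) + 2 * (q + s) ≡ 2 * (2 * q) + 4 * s
    collect = solve-∀
  iv : t + t' ≤ 2 * q
  iv = begin
    t + t' ≤⟨ +-mono-≤ (≤-trans t≤s s≤q) (≤-trans t'≤s s≤q) ⟩
    q + q  ≡⟨ cong (q +_) (+-identityʳ q) ⟨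
    2 * q  ∎
  v : 4 * u + 4 * w ≤ 4 * (2 * q)
  v = begin
    4 * u + 4 * w       ≤⟨ iii ⟩
    2 * (2 * q) + 4 * s ≤⟨ +-monoʳ-≤ (2 * (2 * q)) (*-monoʳ-≤ 4 s≤q) ⟩
    2 * (2 * q) + 4 * q ≡⟨ collect q ⟩
    4 * (2 * q)         ∎
    where
    collect : ∀ q → 2 * (2 * q) + 4 * q ≡ 4 * (2 * q)
    collect = solve-∀

halve : ∀ {x y} → 2 * x ≤ y + y → x ≤ y
halve {x} {y} 2x≤y+y = *-cancelˡ-≤ 2 (subst (2 * x ≤_) (cong (y +_) (sym (+-identityʳ y))) 2x≤y+y)

module Representatives (D : OrientedGraph) where
  open CycleCounts D

  q s t t' u w : ℕ
  q  = homC4 D true  false true  false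
  s  = homC4 D true  true  false false
  t  = homC4 D true  true  true  true
  t' = homC4 D false false false false
  u  = homC4 D true  false false false
  w  = homC4 D true  true  true  false

  FFTT≡s : homC4 D false false true true ≡ s
  FFTT≡s = sym (trans (homC4-rotate true true false false) (homC4-rotate true false false true))

  t≤s : t ≤ s
  t≤s = halve (homC4-amgm true true true true)

  t'≤s : t' ≤ s
  t'≤s = halve (subst (λ e → 2 * t' ≤ e + e) FFTT≡s (homC4-amgm false false false false))

  s≤q : s ≤ q
  s≤q = halve (begin
    2 * s                                       ≡⟨ cong (2 *_) (homC4-rotate false true true false) ⟨
    2 * homC4 D false true true false           ≤⟨ homC4-amgm false true true false ⟩
    homC4 D false true false true + q           ≡⟨ cong (_+ q) (homC4-rotate false true false true) ⟩
    q + q                                       ∎)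
    where open ≤-Reasoning

  2u≤q+s : 2 * u ≤ q + s
  2u≤q+s = subst (λ e → 2 * u ≤ q + e) FFTT≡s (homC4-amgm true false false false)

  2w≤q+s : 2 * w ≤ q + s
  2w≤q+s = subst (2 * w ≤_) (+-comm s q) (homC4-amgm true true true false)

  -- Each hom_T expressed through the representatives, using that the cycle
  -- count is constant on rotation classes.
  homT-I : homT I D ≡ t + t'
  homT-I = typeSum-I (homC4 D)

  homT-II : homT II D ≡ 4 * u + 4 * w
  homT-II = trans (typeSum-II (homC4 D))
    (cong₂ _+_ (orbitSum-invariant (homC4 D) homC4-rotate true false false false)
               (orbitSum-invariant (homC4 D) homC4-rotate true true true false))

  homT-III : homT III D ≡ 4 * s
  homT-III = trans (typeSum-III (homC4 D)) (orbitSum-invariant (homC4 D) homC4-rotate true true false false)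

  homT-IV : homT IV D ≡ 2 * q
  homT-IV = begin
    homT IV D                         ≡⟨ typeSum-IV (homC4 D) ⟩
    q + homC4 D false true false true ≡⟨ cong (q +_) (homC4-rotate true false true false) ⟨
    q + q                             ≡⟨ cong (q +_) (+-identityʳ q) ⟨
    2 * q                             ∎
    where open ≡-Reasoning

lemma3p2 : (D : OrientedGraph) →
    (2 * homT IV D ≥ homT III D) ×
    (homT III D ≥ 2 * homT I D) ×
    (2 * homT IV D + homT III D ≥ homT II D) ×
    (homT IV D ≥ homT I D) ×
    (4 * homT IV D ≥ homT II D)
lemma3p2 D =
  linear-consequences q s t t' u w homT-I homT-II homT-III homT-IV t≤s t'≤s s≤q 2u≤q+s 2w≤q+s
  where open Representatives D
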